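{- Let $s\geqslant2$, let $p$ be an $s$-point and $i\in\{0,\dots,s-1\}$. Let $\mathcal{B}$ be the alcove containing $p$, let $H$ be the unique hyperplane in $\mathcal{H}$ separating $\mathcal{B}$ from the (adjacent) alcove containing $\chi_1(\sigma_i)(p)$, and let $\lambda$ be the $s$-core corresponding to $p$. Suppose the origin $(0,1,\dots,s-1)$ lies on the same side of $H$ as $p$. Then $[\chi_1(\sigma_i)(\lambda)]\supseteq[\lambda]$.
   Context: $P^s=\{p\in\mathbb{R}^s:p_1+\dots+p_s=\binom s2\}$; $H_{ij}^k=\{p\in P^s:p_j-p_i=ks\}$; $\mathcal{H}=\{H_{ij}^k:1\leqslant i<j\leqslant s,k\in\mathbb{Z}\}$; alcoves are the connected components of the complement of $\bigcup\mathcal{H}$ in $P^s$. An $s$-point is a point of $P^s$ with integer coordinates pairwise incongruent mod $s$; each alcove contains exactly one. The level 1 action $\chi_1$ of $\hat{\mathfrak{S}}_s$ (generators $\sigma_0,\dots,\sigma_{s-1}$, relations $\sigma_i^2=1$, $\sigma_i\sigma_j=\sigma_j\sigma_i$ for $i\not\equiv j\pm1$, $\sigma_i\sigma_j\sigma_i=\sigma_j\sigma_i\sigma_j$ for $i\equiv j+1\not\equiv j-1\pmod s$) on $s$-points: $\chi_1(\sigma_i)(p)$ replaces the coordinate $p_j\equiv i-1$ by $p_j+1$ and the coordinate $p_k\equiv i\pmod s$ by $p_k-1$; it induces the same rule on unordered sets of coordinates. For a partition $\lambda$, $[\lambda]=\{(i,j)\in\mathbb{N}^2:j\leqslant\lambda_i\}$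 and the beta-set is $\{\lambda_i-i:i\geqslant1\}$. For an $s$-core $\lambda$ and $r\in\{0,\dots,s-1\}$ let $a_r$ be the smallest integer $\equiv r\pmod s$ not in the beta-set; $\mathcal{Q}(\lambda)=\{a_0,\dots,a_{s-1}\}$, a bijection onto sets of $s$ integers pairwise incongruent mod $s$ summing to $\binom s2$. The $s$-core corresponding to an $s$-point $p$ is the $\lambda$ with $\mathcal{Q}(\lambda)=\{p_1,\dots,p_s\}$, and $\chi_1$ acts on $s$-cores via this bijection. -}

module Defs where

open import Data.Nat as ℕ using (ℕ; zero; suc; _≤?_)
open import Data.Nat.Divisibility as ℕD using ()
open import Data.Nat.Combinatorics using (_C_)
open import Data.Integer as ℤ using (ℤ; +_; _-_; _+_; _*_; ∣_∣; _<_; _≤_)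
open import Data.Integer.Divisibility using (_∣_)
open import Data.Fin using (Fin; toℕ) renaming (zero to fzero; suc to fsuc)
open import Data.List using (List; []; _∷_; length; filter)
open import Data.List.Relation.Unary.All using (All)
open import Data.List.Relation.Unary.Linked using (Linked)
open import Data.Product using (Σ; _×_)
open import Relation.Nullary using (¬_; yes; no)
open import Relation.Binary.PropositionalEquality using (_≡_; _≢_)
open import Function using (_⇔_)
open import Data.Sum using (_⊎_)

_≡_[mod_] : ℤ → ℤ → ℕ → Set
a ≡ b [mod s ] = (+ s) ∣ (a - b)

-- Points of P^s with integer coordinates, coordinates indexed by Fin s
-- (Fin s index t stands for coordinate t+1 of the paper).

sumℤ : ∀ {n} → (Fin n → ℤ) → ℤ
sumℤ {zero}  f = + 0
sumℤ {suc n} f = f fzero + sumℤ (λ t → f (fsuc t))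

IsSPoint : (s : ℕ) → (Fin s → ℤ) → Set
IsSPoint s p =
  (sumℤ p ≡ + (s C 2)) ×
  (∀ a b → a ≢ b → ¬ (p a ≡ p b [mod s ]))

origin : (s : ℕ) → Fin s → ℤ
origin s t = + toℕ t

chi1 : (s : ℕ) → Fin s → (Fin s → ℤ) → (Fin s → ℤ)
chi1 s i p t with ℕD._∣?_ s ∣ p t - ((+ toℕ i) - + 1) ∣
... | yes _ = p t + + 1
... | no _ with ℕD._∣?_ s ∣ p t - (+ toℕ i) ∣
...   | yes _ = p t - + 1
...   | no _  = p t

-- Hyperplanes H_{ab}^k = { x : x_b - x_a = k s } and their sides

hval : (s : ℕ) → Fin s → Fin s → ℤ → (Fin s → ℤ) → ℤ
hval s a b k x = (x b - x a) - k * + s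

Separates : (s : ℕ) → Fin s → Fin s → ℤ → (Fin s → ℤ) → (Fin s → ℤ) → Set
Separates s a b k x y =
  ((hval s a b k x < + 0) × (+ 0 < hval s a b k y)) ⊎
  ((+ 0 < hval s a b k x) × (hval s a b k y < + 0))

SameSide : (s : ℕ) → Fin s → Fin s → ℤ → (Fin s → ℤ) → (Fin s → ℤ) → Set
SameSide s a b k x y =
  ((hval s a b k x < + 0) × (hval s a b k y < + 0)) ⊎
  ((+ 0 < hval s a b k x) × (+ 0 < hval s a b k y))

record Partition : Set where
  constructor mkPartition
  field
    parts    : List ℕ
    decr     : Linked ℕ._≥_ parts
    positive : All (1 ℕ.≤_) parts
open Partition public

-- λ_i for i ≥ 1 (1-indexed; λ_i = 0 beyond the length; part _ 0 = 0 is junk)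
partL : List ℕ → ℕ → ℕ
partL []       _             = 0
partL (x ∷ xs) zero          = 0
partL (x ∷ xs) (suc zero)    = x
partL (x ∷ xs) (suc (suc n)) = partL xs (suc n)

part : Partition → ℕ → ℕ
part la i = partL (parts la) i

conjPart : Partition → ℕ → ℕ
conjPart la j = length (filter (j ≤?_) (parts la))

InDiagram : Partition → ℕ → ℕ → Set
InDiagram la i j = (1 ℕ.≤ i) × (1 ℕ.≤ j) × (j ℕ.≤ part la i)

_⊆D_ : Partition → Partition → Set
la ⊆D mu = ∀ i j → InDiagram la i j → InDiagram mu i j

hook : Partition → ℕ → ℕ → ℕ
hook la i j = (part la i ℕ.∸ j) ℕ.+ (conjPart la j ℕ.∸ i) ℕ.+ 1

IsCore : ℕ → Partition → Set
IsCore s la = ∀ i j → InDiagram la i j → ¬ (s ℕD.∣ hook la i j)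

InBeta : Partition → ℤ → Set
InBeta la x = Σ ℕ (λ i → (1 ℕ.≤ i) × (x ≡ (+ part la i) - (+ i)))

IsA : (s : ℕ) → Partition → Fin s → ℤ → Set
IsA s la r a =
  (a ≡ + toℕ r [mod s ]) × (¬ InBeta la a) ×
  (∀ y → y ≡ + toℕ r [mod s ] → ¬ InBeta la y → a ≤ y)

QEq : (s : ℕ) → Partition → (Fin s → ℤ) → Set
QEq s la p = ∀ x → (Σ (Fin s) (λ r → IsA s la r x)) ⇔ (Σ (Fin s) (λ t → p t ≡ x))

CoreOf : (s : ℕ) → (Fin s → ℤ) → Partition → Set
CoreOf s p la = IsCore s la × QEq s la p

module Submission where

-- The proof works with beta-sets on the s-abacus.  χ₁(σ_i) raises the
-- coordinate x ≡ i - 1 and lowers the coordinate y ≡ i (mod s).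
--   * HookLengths: if z = λ_i - i is a beta number and z - s is not, [λ] has a
--     hook of length s.  Hence (Abacus) for an s-core the beta numbers in the
--     class of a coordinate p_t are exactly the integers of that class below p_t.
--   * Action: a wall separating p from χ₁(σ_i)(p) lies between a raised and a
--     lowered coordinate, and the origin being on the side of p forces y ≤ x + 1.
--   * Containment: pushing the beads z ≡ i - 1 with z ≥ y - 1 to z + 1 is a
--     strictly increasing map from the beta-set of λ into that of μ, so by a
--     domination lemma the n-th beta numbers satisfy β_n(λ) ≤ β_n(μ), i.e.
--     λ_n ≤ μ_n.  Beta-set membership is only known up to double negation, which
--     suffices because the order on ℤ is decidable.

open import Defs

module HookLengths where

  open import Data.Nat
  open import Data.Nat.Properties
  open import Data.List using ([]; _∷_; length; filter)
  open import Data.List.Properties using (filter-accept; filter-reject)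
  open import Data.List.Relation.Unary.Linked using (Linked; []; [-]; _∷_)
  open import Data.Product
  open import Data.Empty
  open import Relation.Nullary
  open import Relation.Binary.Bundles using (Preorder)
  open import Relation.Binary.PropositionalEquality
  open import Data.Nat.Tactic.RingSolver using (solve-∀)

  antitone-by-step : ∀ {c ℓ₁ ℓ₂} (P : Preorder c ℓ₁ ℓ₂) (f : ℕ → Preorder.Carrier P)
    → (∀ n → Preorder._≲_ P (f (suc n)) (f n))
    → ∀ {m n} → m ≤ n → Preorder._≲_ P (f n) (f m)
  antitone-by-step P f step {m} m≤n with m≤n⇒∃[o]m+o≡n m≤n
  ... | d , refl = subst (λ k → f k ≲ f m) (+-comm d m) (descend d)
    where
    open Preorder P using (_≲_) renaming (refl to ≲-refl; trans to ≲-trans)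
    descend : ∀ d → f (d + m) ≲ f m
    descend zero    = ≲-refl
    descend (suc d) = ≲-trans (step (d + m)) (descend d)

  partL-step : ∀ xs → Linked _≥_ xs → ∀ n → partL xs (suc (suc n)) ≤ partL xs (suc n)
  partL-step []           _          _       = z≤n
  partL-step (x ∷ [])     _          zero    = z≤n
  partL-step (x ∷ [])     _          (suc n) = z≤n
  partL-step (x ∷ y ∷ ys) (x≥y ∷ _)  zero    = x≥y
  partL-step (x ∷ y ∷ ys) (_ ∷ l)    (suc n) = partL-step (y ∷ ys) l n

  part-antitone : ∀ la {m n} → 1 ≤ m → m ≤ n → part la n ≤ part la m
  part-antitone la {suc m} {suc n} _ (s≤s m≤n) =
    antitone-by-step ≤-preorder (λ k → part la (suc k)) (partL-step (parts la) (decr la)) m≤n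

  count-parts : ∀ j xs m → Linked _≥_ xs
    → (∀ k → 1 ≤ k → k ≤ m → j ≤ partL xs k) → partL xs (suc m) < j
    → length (filter (j ≤?_) xs) ≡ m
  count-parts j []       zero    _ _     _    = refl
  count-parts j []       (suc m) _ large small = ⊥-elim (<⇒≱ small (large 1 (s≤s z≤n) (s≤s z≤n)))
  count-parts j (x ∷ xs) zero    l _     x<j = none-large x xs l x<j
    where
    none-large : ∀ x xs → Linked _≥_ (x ∷ xs) → x < j → length (filter (j ≤?_) (x ∷ xs)) ≡ 0
    none-large x []       _         x<j rewrite filter-reject (j ≤?_) {x} {[]} (<⇒≱ x<j) = refl
    none-large x (y ∷ ys) (x≥y ∷ l) x<j rewrite filter-reject (j ≤?_) {x} {y ∷ ys} (<⇒≱ x<j) =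
      none-large y ys l (≤-<-trans x≥y x<j)
  count-parts j (x ∷ xs) (suc m) l large small
    rewrite filter-accept (j ≤?_) {x} {xs} (large 1 (s≤s z≤n) (s≤s z≤n)) =
    cong suc (count-parts j xs m (tail l) (λ { (suc k) _ k≤m → large (suc (suc k)) (s≤s z≤n) (s≤s k≤m) }) small)
    where
    tail : Linked _≥_ (x ∷ xs) → Linked _≥_ xs
    tail [-]     = []
    tail (_ ∷ l) = l

  last-before-failure : (Q : ℕ → Set) → (∀ k → Dec (Q k)) → ∀ n k → Q k → ¬ Q (n + k)
    → Σ ℕ λ m → k ≤ m × Q m × ¬ Q (suc m)
  last-before-failure Q Q? zero    k q ¬q = ⊥-elim (¬q q)
  last-before-failure Q Q? (suc n) k q ¬q with Q? (suc k)
  ... | no ¬q′ = k , ≤-refl , q , ¬q′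
  ... | yes q′ with last-before-failure Q Q? n (suc k) q′ (subst (λ z → ¬ Q z) (sym (+-suc n k)) ¬q)
  ...   | m , k<m , qm , ¬qm = m , ≤-trans (n≤1+n k) k<m , qm , ¬qm

  arm-leg-sum : ∀ {a b c d} s → c ≤ a → b ≤ d → c + (b + s) ≡ a + suc d
    → (a ∸ c) + (d ∸ b) + 1 ≡ s
  arm-leg-sum {b = b} {c = c} s c≤a b≤d eq with m≤n⇒∃[o]m+o≡n c≤a | m≤n⇒∃[o]m+o≡n b≤d
  ... | e , refl | f , refl rewrite m+n∸m≡n c e | m+n∸m≡n b f =
    sym (+-cancelˡ-≡ b _ _ (+-cancelˡ-≡ c _ _ (trans eq (regroup c e b f))))
    where
    regroup : ∀ c e b f → c + e + suc (b + f) ≡ c + (b + (e + f + 1))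
    regroup = solve-∀

  module _ (s : ℕ) (la : Partition) {i : ℕ} (i≥1 : 1 ≤ i) where
    private
      P : ℕ → ℕ
      P = part la

    -- Row m is the last row whose beta number λ_m - m lies above λ_i - i - s,
    -- and λ_{m+1} - (m+1) lies strictly below it.  Then the column j with
    -- λ_i - i - s = j - m - 1 carries a hook of length s in row i.
    hook-at-crossing : ∀ {m} → i ≤ m → P i + m < P m + (i + s)
      → P (suc m) + (i + s) < P i + suc m
      → Σ ℕ λ j → InDiagram la i j × hook la i j ≡ s
    hook-at-crossing {m} i≤m above below = j , (i≥1 , j≥1 , j≤Pi) , hook≡s
      where
      j : ℕ
      j = (P i + suc m) ∸ (i + s)
      j-def : j + (i + s) ≡ P i + suc m
      j-def = m∸n+n≡m (≤-trans (m≤n+m (i + s) (P (suc m))) (<⇒≤ below))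
      below-j : P (suc m) < j
      below-j = +-cancelʳ-< (i + s) (P (suc m)) j (subst (P (suc m) + (i + s) <_) (sym j-def) below)
      j≥1 : 1 ≤ j
      j≥1 = ≤-trans (s≤s z≤n) below-j
      j≤Pm : j ≤ P m
      j≤Pm = +-cancelʳ-≤ (i + s) j (P m)
        (subst (_≤ P m + (i + s)) (trans (sym (+-suc (P i) m)) (sym j-def)) above)
      j≤Pi : j ≤ P i
      j≤Pi = ≤-trans j≤Pm (part-antitone la i≥1 i≤m)
      leg : conjPart la j ≡ m
      leg = count-parts j (parts la) m (decr la)
        (λ k k≥1 k≤m → ≤-trans j≤Pm (part-antitone la k≥1 k≤m)) below-j
      hook≡s : hook la i j ≡ s
      hook≡s = trans (cong (λ l → (P i ∸ j) + (l ∸ i) + 1) leg) (arm-leg-sum s j≤Pi i≤m j-def)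

    -- If λ_i - i - s is not a beta number, then [λ] has a hook of length s.
    hook-of-gap : 1 ≤ s → (∀ k → 1 ≤ k → P k + (i + s) ≢ P i + k)
      → Σ ℕ λ j → InDiagram la i j × hook la i j ≡ s
    hook-of-gap s≥1 gap =
      let m , i≤m , above , ¬above = last-before-failure Above (λ k → P i + k <? P k + (i + s)) s i above-i not-above
      in hook-at-crossing i≤m above (≤∧≢⇒< (≮⇒≥ ¬above) (gap (suc m) (s≤s z≤n)))
      where
      Above : ℕ → Set
      Above k = P i + k < P k + (i + s)
      above-i : Above i
      above-i = +-monoʳ-< (P i) (m<m+n i s≥1)
      not-above : ¬ Above (s + i)
      not-above a = <⇒≱ a (subst (P (s + i) + (i + s) ≤_) (cong (P i +_) (+-comm i s))
        (+-monoˡ-≤ (i + s) (part-antitone la i≥1 (m≤n+m i s))))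

module Abacus where

  open HookLengths using (antitone-by-step; partL-step; hook-of-gap)
  open import Data.Nat as ℕ using (ℕ; zero; suc; s≤s; z≤n)
  import Data.Nat.Properties as ℕP
  import Data.Nat.Divisibility as ℕD
  open import Data.Integer as ℤ using (ℤ; +_; _+_; _-_; _*_; -_; _≤_; _<_; +≤+; -≤+; -≤-; +<+; ∣_∣)
  import Data.Integer.Properties as ℤP
  import Data.Integer.Divisibility.Signed as ℤS
  open import Data.Integer.DivMod using (_%ℕ_; _/ℕ_; n%ℕd<d; a≡a%ℕn+[a/ℕn]*n)
  open import Data.Integer.Tactic.RingSolver using (solve-∀)
  open import Data.Fin as Fin using (Fin; toℕ)
  import Data.Fin.Properties as FinP
  open import Data.Product
  open import Data.Sum
  open import Data.Unit using (⊤; tt)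
  open import Data.Empty
  open import Function using (_∘_)
  open import Function.Bundles using (Equivalence)
  open import Function.Definitions using (Injective)
  open import Relation.Nullary
  open import Relation.Nullary.Decidable using (map′; decidable-stable; _×-dec_)
  open import Relation.Binary.PropositionalEquality

  ≤-by-difference : ∀ {a b c d : ℤ} → a ≤ b → c - d ≡ b - a → d ≤ c
  ≤-by-difference le eq = ℤP.0≤i-j⇒j≤i (subst (+ 0 ≤_) (sym eq) (ℤP.i≤j⇒0≤j-i le))

  <-by-difference : ∀ {a b c d : ℤ} → a < b → c - d ≡ b - a → d < c
  <-by-difference {a} {b} {c} {d} lt eq =
    ℤP.suc[i]≤j⇒i<j (≤-by-difference (ℤP.i<j⇒suc[i]≤j lt) (trans (shift c d) (trans (cong (_- + 1) eq) (sym (shift b a)))))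
    where
    shift : ∀ x y → x - (+ 1 + y) ≡ (x - y) - + 1
    shift = solve-∀

  shifted-difference : ∀ a i s b k → b ℕ.+ (i ℕ.+ s) ≡ a ℕ.+ k → (+ a - + i) - + s ≡ + b - + k
  shifted-difference a i s b k eq = begin
    (+ a - + i) - + s                    ≡⟨ add-and-remove (+ a) (+ i) (+ s) (+ k) ⟩
    (+ a + + k) - (+ i + + s) - + k      ≡⟨ cong₂ (λ x y → x - y - + k) (sym (ℤP.pos-+ a k)) (sym (ℤP.pos-+ i s)) ⟩
    + (a ℕ.+ k) - + (i ℕ.+ s) - + k      ≡⟨ cong (λ x → + x - + (i ℕ.+ s) - + k) (sym eq) ⟩
    + (b ℕ.+ (i ℕ.+ s)) - + (i ℕ.+ s) - + k  ≡⟨ cong (λ x → x - + (i ℕ.+ s) - + k) (ℤP.pos-+ b (i ℕ.+ s)) ⟩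
    (+ b + + (i ℕ.+ s)) - + (i ℕ.+ s) - + k  ≡⟨ cancel (+ b) (+ (i ℕ.+ s)) (+ k) ⟩
    + b - + k                            ∎
    where
    open ≡-Reasoning
    add-and-remove : ∀ a i s k → (a - i) - s ≡ (a + k) - (i + s) - k
    add-and-remove = solve-∀
    cancel : ∀ b n k → (b + n) - n - k ≡ b - k
    cancel = solve-∀

  -- Congruence modulo s, packaged as a record so that the two integers can be
  -- inferred from its type (the unfolded `a ≡ b [mod s ]` only mentions ∣ a - b ∣).
  infix 4 _≡_⟨mod_⟩
  record _≡_⟨mod_⟩ (a b : ℤ) (s : ℕ) : Set where
    constructor mod
    field unmod : a ≡ b [mod s ]
  open _≡_⟨mod_⟩ public

  module _ {s : ℕ} where

    signed : ∀ {a b} → a ≡ b ⟨mod s ⟩ → (+ s) ℤS.∣ (a - b)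
    signed {a} {b} (mod d) = ℤS.∣ᵤ⇒∣ {+ s} {a - b} d

    unsigned : ∀ {a b} → (+ s) ℤS.∣ (a - b) → a ≡ b ⟨mod s ⟩
    unsigned d = mod (ℤS.∣⇒∣ᵤ d)

    mod? : ∀ a b → Dec (a ≡ b ⟨mod s ⟩)
    mod? a b = map′ mod unmod (ℕD._∣?_ s ∣ a - b ∣)

    mod-sym : ∀ {a b} → a ≡ b ⟨mod s ⟩ → b ≡ a ⟨mod s ⟩
    mod-sym {a} {b} a≡b with signed a≡b
    ... | ℤS.divides q eq = unsigned (ℤS.divides (- q) (trans (flip a b) (trans (cong -_ eq) (ℤP.neg-distribˡ-* q (+ s)))))
      where
      flip : ∀ a b → b - a ≡ - (a - b)
      flip = solve-∀

    mod-trans : ∀ {a b c} → a ≡ b ⟨mod s ⟩ → b ≡ c ⟨mod s ⟩ → a ≡ c ⟨mod s ⟩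
    mod-trans {a} {b} {c} a≡b b≡c =
      unsigned (subst ((+ s) ℤS.∣_) (telescope a b c) (ℤS.∣m∣n⇒∣m+n (signed a≡b) (signed b≡c)))
      where
      telescope : ∀ a b c → (a - b) + (b - c) ≡ a - c
      telescope = solve-∀

    mod-+ : ∀ {a b} c → a ≡ b ⟨mod s ⟩ → a + c ≡ b + c ⟨mod s ⟩
    mod-+ {a} {b} c a≡b = unsigned (subst ((+ s) ℤS.∣_) (translate a b c) (signed a≡b))
      where
      translate : ∀ a b c → a - b ≡ (a + c) - (b + c)
      translate = solve-∀

    mod-above : ∀ {a b} → a ≡ b ⟨mod s ⟩ → b ≤ a → Σ ℕ λ q → a ≡ b + + (q ℕ.* s)
    mod-above {a} {b} (mod d) b≤a = ℕD._∣_.quotient d , (begin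
      a                     ≡⟨ split a b ⟩
      b + (a - b)           ≡⟨ cong (λ x → b + x) (sym (ℤP.0≤i⇒+∣i∣≡i (ℤP.i≤j⇒0≤j-i b≤a))) ⟩
      b + + ∣ a - b ∣       ≡⟨ cong (λ n → b + + n) (ℕD._∣_.equality d) ⟩
      b + + (ℕD._∣_.quotient d ℕ.* s) ∎)
      where
      open ≡-Reasoning
      split : ∀ a b → a ≡ b + (a - b)
      split = solve-∀

  β : Partition → ℕ → ℤ
  β la n = + part la (suc n) - + suc n

  β-decreasing : ∀ la n → β la (suc n) < β la n
  β-decreasing la n = ℤP.≤-<-trans
    (ℤP.+-monoˡ-≤ (- + suc (suc n)) (+≤+ (partL-step (parts la) (decr la) n)))
    (ℤP.+-monoʳ-< (+ part la (suc n)) (ℤP.neg-mono-< (+<+ ℕP.≤-refl)))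

  InBeta⇒β : ∀ la {z} → InBeta la z → Σ ℕ λ n → z ≡ β la n
  InBeta⇒β la (suc n , _ , eq) = n , eq

  β⇒InBeta : ∀ la n → InBeta la (β la n)
  β⇒InBeta la n = suc n , s≤s z≤n , refl

  module _ {s : ℕ} (s≥1 : 1 ℕ.≤ s) (la : Partition) (core : IsCore s la) where

    -- In an s-core the beta-set is closed under z ↦ z - s: a beta number z with
    -- z - s missing would produce a hook of length s (up to double negation,
    -- as membership in the beta-set is not decidable here).
    core-beta-step : ∀ {z} → InBeta la z → ¬ ¬ InBeta la (z - + s)
    core-beta-step {z} (i , i≥1 , z≡) ¬next =
      let j , node , hook≡s = hook-of-gap s la i≥1 s≥1 no-bead-at-z-s
      in core i j node (subst (s ℕD.∣_) (sym hook≡s) ℕD.∣-refl)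
      where
      no-bead-at-z-s : ∀ k → 1 ℕ.≤ k → part la k ℕ.+ (i ℕ.+ s) ≢ part la i ℕ.+ k
      no-bead-at-z-s k k≥1 eq =
        ¬next (k , k≥1 , trans (cong (_- + s) z≡) (shifted-difference (part la i) i s (part la k) k eq))

    beta-below-gap : ∀ {z a} → InBeta la z → ¬ InBeta la a → z ≡ a ⟨mod s ⟩ → z < a
    beta-below-gap {z} {a} bz ¬ba z≡a = ℤP.≰⇒> λ a≤z →
      let q , z≡ = mod-above z≡a a≤z in descend q bz z≡
      where
      descend : ∀ q {z} → InBeta la z → z ≡ a + + (q ℕ.* s) → ⊥
      descend zero    bz z≡ = ¬ba (subst (InBeta la) (trans z≡ (ℤP.+-identityʳ a)) bz)
      descend (suc q) {z} bz z≡ = core-beta-step bz (λ b → descend q b (begin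
        z - + s                        ≡⟨ cong (_- + s) z≡ ⟩
        a + + (s ℕ.+ q ℕ.* s) - + s    ≡⟨ cong (λ x → a + x - + s) (ℤP.pos-+ s (q ℕ.* s)) ⟩
        a + (+ s + + (q ℕ.* s)) - + s  ≡⟨ cancel a (+ s) (+ (q ℕ.* s)) ⟩
        a + + (q ℕ.* s)                ∎))
        where
        open ≡-Reasoning
        cancel : ∀ a s m → a + (s + m) - s ≡ a + m
        cancel = solve-∀

  module _ {s : ℕ} {p : Fin s → ℤ} (la : Partition) where

    beta-below-coordinate : 1 ℕ.≤ s → CoreOf s p la → ∀ {z} t → z ≡ p t ⟨mod s ⟩ → InBeta la z → z < p t
    beta-below-coordinate s≥1 (core , q) t z≡pt bz =
      let _ , _ , pt∉β , _ = Equivalence.from (q (p t)) (t , refl)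
      in beta-below-gap s≥1 la core bz pt∉β z≡pt

    below-coordinate-beta : QEq s la p → ∀ {w} t → w ≡ p t ⟨mod s ⟩ → w < p t → ¬ ¬ InBeta la w
    below-coordinate-beta q {w} t w≡pt w<pt w∉β =
      let _ , pt≡r , _ , least = Equivalence.from (q (p t)) (t , refl)
      in ℤP.<⇒≱ w<pt (least w (unmod (mod-trans w≡pt (mod pt≡r))) w∉β)

  injective⇒surjective : ∀ {n} (f : Fin n → Fin n) → Injective _≡_ _≡_ f → ∀ y → Σ (Fin n) λ x → f x ≡ y
  injective⇒surjective {suc n} f inj y with FinP.any? (λ x → f x FinP.≟ y)
  ... | yes hit  = hit
  ... | no  miss =
    let x₁ , x₂ , x₁<x₂ , same = FinP.pigeonhole (ℕP.n<1+n n) (λ x → Fin.punchOut (avoids x))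
    in ⊥-elim (FinP.<⇒≢ x₁<x₂ (inj (FinP.punchOut-injective (avoids x₁) (avoids x₂) same)))
    where
    avoids : ∀ x → y ≢ f x
    avoids x y≡fx = miss (x , sym y≡fx)

  module _ {s′ : ℕ} where
    private
      s = suc s′

    residue : ℤ → Fin s
    residue a = Fin.fromℕ< (n%ℕd<d a s)

    same-residue : ∀ {a b} → residue a ≡ residue b → a ≡ b ⟨mod s ⟩
    same-residue {a} {b} e = unsigned (ℤS.divides (a /ℕ s - b /ℕ s) (begin
      a - b                                                   ≡⟨ cong₂ _-_ (a≡a%ℕn+[a/ℕn]*n a s) (a≡a%ℕn+[a/ℕn]*n b s) ⟩
      (+ (a %ℕ s) + (a /ℕ s) * + s) - (+ (b %ℕ s) + (b /ℕ s) * + s) ≡⟨ cong (λ r → (+ r + (a /ℕ s) * + s) - (+ (b %ℕ s) + (b /ℕ s) * + s)) remainders ⟩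
      (+ (b %ℕ s) + (a /ℕ s) * + s) - (+ (b %ℕ s) + (b /ℕ s) * + s) ≡⟨ cancel (+ (b %ℕ s)) (a /ℕ s) (b /ℕ s) (+ s) ⟩
      (a /ℕ s - b /ℕ s) * + s                                 ∎))
      where
      open ≡-Reasoning
      remainders : a %ℕ s ≡ b %ℕ s
      remainders = trans (sym (FinP.toℕ-fromℕ< (n%ℕd<d a s))) (trans (cong toℕ e) (FinP.toℕ-fromℕ< (n%ℕd<d b s)))
      cancel : ∀ r u v s → (r + u * s) - (r + v * s) ≡ (u - v) * s
      cancel = solve-∀

    every-class-occurs : (p : Fin s → ℤ) → (∀ a b → a ≢ b → ¬ (p a ≡ p b [mod s ]))
      → ∀ z → Σ (Fin s) λ t → z ≡ p t ⟨mod s ⟩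
    every-class-occurs p incongruent z =
      let t , same = injective⇒surjective (residue ∘ p) residue-injective (residue z)
      in t , mod-sym (same-residue same)
      where
      residue-injective : Injective _≡_ _≡_ (residue ∘ p)
      residue-injective {t₁} {t₂} same =
        decidable-stable (t₁ FinP.≟ t₂) (λ t₁≢t₂ → incongruent t₁ t₂ t₁≢t₂ (unmod (same-residue {p t₁} {p t₂} same)))

  -- h and h′ lie strictly on opposite sides of 0; `Separates s a b k x y` is by
  -- definition this relation between the signed positions of x and y w.r.t. H^k_ab.
  Opposite : ℤ → ℤ → Set
  Opposite h h′ = ((h < + 0) × (+ 0 < h′)) ⊎ ((+ 0 < h) × (h′ < + 0))

  -- h and h′ lie strictly on the same side of 0; `SameSide` unfolds to this.
  SameSign : ℤ → ℤ → Set
  SameSign h h′ = ((h < + 0) × (h′ < + 0)) ⊎ ((+ 0 < h) × (+ 0 < h′))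

  same-sign-positive : ∀ {h h′} → SameSign h h′ → + 0 < h′ → + 0 < h
  same-sign-positive (inj₁ (_ , h′<0)) 0<h′ = ⊥-elim (ℤP.<-asym h′<0 0<h′)
  same-sign-positive (inj₂ (0<h , _))  _    = 0<h

  same-sign-negative : ∀ {h h′} → SameSign h h′ → h′ < + 0 → h < + 0
  same-sign-negative (inj₁ (h<0 , _))  _    = h<0
  same-sign-negative (inj₂ (_ , 0<h′)) h′<0 = ⊥-elim (ℤP.<-asym h′<0 0<h′)

  no-integer-between : ∀ {a b} → a < b → b < a + + 1 → ⊥
  no-integer-between {a} {b} a<b b<a+1 =
    ℤP.<-irrefl refl (ℤP.<-≤-trans b<a+1 (subst (_≤ b) (ℤP.+-comm (+ 1) a) (ℤP.i<j⇒suc[i]≤j a<b)))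

  close-not-opposite : ∀ {h h′} → h′ ≤ h + + 1 → h ≤ h′ + + 1 → ¬ Opposite h h′
  close-not-opposite h′≤h+1 _ (inj₁ (h<0 , 0<h′)) = no-integer-between h<0 (ℤP.<-≤-trans 0<h′ h′≤h+1)
  close-not-opposite _ h≤h′+1 (inj₂ (0<h , h′<0)) = no-integer-between h′<0 (ℤP.<-≤-trans 0<h h≤h′+1)

  small-shift-not-opposite : ∀ h {e} → - + 1 ≤ e → e ≤ + 1 → ¬ Opposite h (h + e)
  small-shift-not-opposite h {e} -1≤e e≤1 = close-not-opposite
    (ℤP.+-monoʳ-≤ h e≤1)
    (≤-by-difference -1≤e (regroup h e))
    where
    regroup : ∀ h e → (h + e + + 1) - h ≡ e - - + 1
    regroup = solve-∀

  crossing-down : ∀ {h} → Opposite h (h - + 2) → + 0 < h × h ≤ + 1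
  crossing-down {h} (inj₁ (h<0 , 0<h-2)) =
    ⊥-elim (ℤP.<-asym h<0 (ℤP.<-trans 0<h-2 (<-by-difference (+<+ (s≤s z≤n)) (regroup h))))
    where
    regroup : ∀ h → h - (h - + 2) ≡ + 2 - + 0
    regroup = solve-∀
  crossing-down {h} (inj₂ (0<h , h-2<0)) = 0<h , ≤-by-difference (ℤP.i<j⇒suc[i]≤j h-2<0) (regroup h)
    where
    regroup : ∀ h → + 1 - h ≡ + 0 - (+ 1 + (h - + 2))
    regroup = solve-∀

  crossing-up : ∀ {h} → Opposite h (h + + 2) → h < + 0 × - + 1 ≤ h
  crossing-up {h} (inj₁ (h<0 , 0<h+2)) = h<0 , ≤-by-difference (ℤP.i<j⇒suc[i]≤j 0<h+2) (regroup h)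
    where
    regroup : ∀ h → h - - + 1 ≡ (h + + 2) - (+ 1 + + 0)
    regroup = solve-∀
  crossing-up {h} (inj₂ (0<h , h+2<0)) =
    ⊥-elim (ℤP.<-asym 0<h (ℤP.<-trans (<-by-difference (+<+ (s≤s z≤n)) (regroup h)) h+2<0))
    where
    regroup : ∀ h → (h + + 2) - h ≡ + 2 - + 0
    regroup = solve-∀

  multiple-below : ∀ {s} k → k * + s < + s → k * + s ≤ + 0
  multiple-below {s} k ks<s = ℤP.≤-trans (ℤP.*-monoʳ-≤-nonNeg (+ s) k≤0) (ℤP.≤-reflexive (ℤP.*-zeroˡ (+ s)))
    where
    k≤0 : k ≤ + 0
    k≤0 = ℤP.i<j⇒i≤pred[j] (ℤP.*-cancelʳ-<-nonNeg {k} {+ 1} (+ s) (subst (k * + s <_) (sym (ℤP.*-identityˡ (+ s))) ks<s))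

  module Action (s : ℕ) (i : Fin s) (p : Fin s → ℤ) where

    raised lowered : ℤ
    raised  = + toℕ i - + 1
    lowered = + toℕ i

    raised+1 : raised + + 1 ≡ lowered
    raised+1 = cancel lowered
      where
      cancel : ∀ x → x - + 1 + + 1 ≡ x
      cancel = solve-∀

    q : Fin s → ℤ
    q = chi1 s i p

    data Move : Set where
      raise lower keep : Move

    shift : Move → ℤ
    shift raise = + 1
    shift lower = - + 1
    shift keep  = + 0

    Trigger : Move → ℤ → Set
    Trigger raise x = x ≡ raised ⟨mod s ⟩
    Trigger lower x = x ≡ lowered ⟨mod s ⟩
    Trigger keep  _ = ⊤

    classify : ∀ t → Σ Move λ m → Trigger m (p t) × q t ≡ p t + shift m
    classify t with ℕD._∣?_ s ℤ.∣ p t - raised ∣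
    ... | yes d = raise , mod d , refl
    ... | no _ with ℕD._∣?_ s ℤ.∣ p t - lowered ∣
    ...   | yes d = lower , mod d , refl
    ...   | no _  = keep , tt , sym (ℤP.+-identityʳ (p t))

    -- A raised coordinate x = p_up and a lowered coordinate y = p_dn with
    -- y ≤ x + 1: all the proof needs from the hypothesis on H and the origin.
    record RaisedLoweredPair : Set where
      field
        up dn    : Fin s
        up-class : p up ≡ raised ⟨mod s ⟩
        up-moves : q up ≡ p up + + 1
        dn-class : p dn ≡ lowered ⟨mod s ⟩
        dn-moves : q dn ≡ p dn - + 1
        dn≤up+1  : p dn ≤ p up + + 1

    module _ {a b : Fin s} (a<b : a Fin.< b) (k : ℤ) where
      private
        K h : ℤ
        K = k * + s
        h = hval s a b k p

      hval-after : ∀ {da db} → q a ≡ p a + da → q b ≡ p b + db → hval s a b k q ≡ h + (db - da)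
      hval-after {da} {db} qa qb = trans (cong₂ (λ x y → (y - x) - K) qa qb) (regroup (p a) (p b) da db K)
        where
        regroup : ∀ pa pb da db K → ((pb + db) - (pa + da)) - K ≡ ((pb - pa) - K) + (db - da)
        regroup = solve-∀

      -- An origin strictly above H^k_ab needs ks < b - a < s, so ks ≤ 0.
      origin-above : + 0 < hval s a b k (origin s) → K ≤ + 0
      origin-above above = multiple-below k (ℤP.<-≤-trans K<b-a (ℤP.≤-trans (ℤP.i-j≤i (+ toℕ b) (+ toℕ a)) (ℤP.<⇒≤ (+<+ (FinP.toℕ<n b)))))
        where
        K<b-a : K < + toℕ b - + toℕ a
        K<b-a = <-by-difference above (regroup (+ toℕ b - + toℕ a) K)
          where
          regroup : ∀ x K → x - K ≡ (x - K) - + 0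
          regroup = solve-∀

      -- Likewise an origin strictly below H^k_ab needs ks > b - a ≥ 0.
      origin-below : hval s a b k (origin s) < + 0 → + 0 ≤ K
      origin-below below = ℤP.<⇒≤ (ℤP.≤-<-trans (ℤP.i≤j⇒0≤j-i (+≤+ (ℕP.<⇒≤ a<b))) b-a<K)
        where
        b-a<K : + toℕ b - + toℕ a < K
        b-a<K = <-by-difference below (regroup (+ toℕ b - + toℕ a) K)
          where
          regroup : ∀ x K → K - x ≡ + 0 - (x - K)
          regroup = solve-∀

      raise-lower : Opposite h (h - + 2) → SameSide s a b k (origin s) p → p b ≤ p a + + 1
      raise-lower sep side =
        let 0<h , h≤1 = crossing-down sep
        in ≤-by-difference (ℤP.+-mono-≤ h≤1 (origin-above (same-sign-positive side 0<h))) (regroup (p a) (p b) k (+ s))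
        where
        regroup : ∀ pa pb k S → (pa + + 1) - pb ≡ (+ 1 + + 0) - (((pb - pa) - k * S) + k * S)
        regroup = solve-∀

      lower-raise : Opposite h (h + + 2) → SameSide s a b k (origin s) p → p a ≤ p b + + 1
      lower-raise sep side =
        let h<0 , -1≤h = crossing-up sep
        in ≤-by-difference (ℤP.+-mono-≤ -1≤h (origin-below (same-sign-negative side h<0))) (regroup (p a) (p b) k (+ s))
        where
        regroup : ∀ pa pb k S → (pb + + 1) - pa ≡ (((pb - pa) - k * S) + k * S) - (- + 1 + + 0)
        regroup = solve-∀

      separation⇒pair : Separates s a b k p q → SameSide s a b k (origin s) p → RaisedLoweredPair
      separation⇒pair sep side =
        let ma , ta , ea = classify a
            mb , tb , eb = classify b
        in by-moves ma mb ta tb ea eb (subst (Opposite h) (hval-after ea eb) sep)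
        where
        by-moves : ∀ ma mb → Trigger ma (p a) → Trigger mb (p b) → q a ≡ p a + shift ma → q b ≡ p b + shift mb
          → Opposite h (h + (shift mb - shift ma)) → RaisedLoweredPair
        by-moves raise lower ta tb ea eb sep′ = record
          { up = a ; dn = b ; up-class = ta ; up-moves = ea ; dn-class = tb ; dn-moves = eb
          ; dn≤up+1 = raise-lower sep′ side }
        by-moves lower raise ta tb ea eb sep′ = record
          { up = b ; dn = a ; up-class = tb ; up-moves = eb ; dn-class = ta ; dn-moves = ea
          ; dn≤up+1 = lower-raise sep′ side }
        by-moves raise raise _ _ _ _ sep′ = ⊥-elim (small-shift-not-opposite h -≤+ (+≤+ z≤n) sep′)
        by-moves raise keep  _ _ _ _ sep′ = ⊥-elim (small-shift-not-opposite h (-≤- z≤n) -≤+ sep′)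
        by-moves lower lower _ _ _ _ sep′ = ⊥-elim (small-shift-not-opposite h -≤+ (+≤+ z≤n) sep′)
        by-moves lower keep  _ _ _ _ sep′ = ⊥-elim (small-shift-not-opposite h -≤+ (+≤+ (s≤s z≤n)) sep′)
        by-moves keep  raise _ _ _ _ sep′ = ⊥-elim (small-shift-not-opposite h -≤+ (+≤+ (s≤s z≤n)) sep′)
        by-moves keep  lower _ _ _ _ sep′ = ⊥-elim (small-shift-not-opposite h (-≤- z≤n) -≤+ sep′)
        by-moves keep  keep  _ _ _ _ sep′ = ⊥-elim (small-shift-not-opposite h -≤+ (+≤+ z≤n) sep′)

  module _ (u w : ℕ → ℤ) (u-dec : ∀ n → u (suc n) < u n) (w-dec : ∀ n → w (suc n) < w n)
           (w-in-u : ∀ n → ¬ ¬ (Σ ℕ λ m → w n ≡ u m)) where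
    private
      u-antitone : ∀ {m n} → m ℕ.≤ n → u n ≤ u m
      u-antitone = antitone-by-step ℤP.≤-preorder u (ℤP.<⇒≤ ∘ u-dec)

      index-order : ∀ {m n} → u m < u n → n ℕ.< m
      index-order lt = ℕP.≰⇒> λ m≤n → ℤP.<⇒≱ lt (u-antitone m≤n)

    -- w n ≤ u n, together with: the value of u taken by w n has index at least
    -- n.  Stability of the decidable ≤ removes the double negation.
    dominated : ∀ n → w n ≤ u n
    index-bound : ∀ n m → w n ≡ u m → n ℕ.≤ m

    dominated n = decidable-stable (w n ℤ.≤? u n) λ w≰u →
      w-in-u n λ (m , wn≡um) → w≰u (subst (_≤ u n) (sym wn≡um) (u-antitone (index-bound n m wn≡um)))

    index-bound zero    _ _     = z≤n
    index-bound (suc n) m wn≡um = index-order (subst (_< u n) wn≡um (ℤP.<-≤-trans (w-dec n) (dominated n)))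

  diagram-containment : ∀ la mu → (∀ n → β la n ≤ β mu n) → la ⊆D mu
  diagram-containment la mu β≤β zero    _ (() , _)
  diagram-containment la mu β≤β (suc n) j (i≥1 , j≥1 , j≤λ) =
    i≥1 , j≥1 , ℕP.≤-trans j≤λ (ℤP.drop‿+≤+ (≤-by-difference (β≤β n) (regroup (+ part la (suc n)) (+ part mu (suc n)) (+ suc n))))
    where
    regroup : ∀ a b m → b - a ≡ (b - m) - (a - m)
    regroup = solve-∀

  module Containment {s′ : ℕ} {i : Fin (suc s′)} {p : Fin (suc s′) → ℤ}
    (incongruent : ∀ a b → a ≢ b → ¬ (p a ≡ p b [mod suc s′ ]))
    (la mu : Partition)
    (λ-core : CoreOf (suc s′) p la)
    (μ-core : CoreOf (suc s′) (chi1 (suc s′) i p) mu)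
    (pair : Action.RaisedLoweredPair (suc s′) i p) where

    open Action (suc s′) i p
    open RaisedLoweredPair pair

    private
      s : ℕ
      s = suc s′

      x y : ℤ
      x = p up
      y = p dn

      λ-below : ∀ {z} t → z ≡ p t ⟨mod s ⟩ → InBeta la z → z < p t
      λ-below = beta-below-coordinate la (s≤s z≤n) λ-core

      μ-beta : ∀ {w} t → w ≡ q t ⟨mod s ⟩ → w < q t → ¬ ¬ InBeta mu w
      μ-beta = below-coordinate-beta mu (proj₂ μ-core)

      y-1≡raised : y - + 1 ≡ raised ⟨mod s ⟩
      y-1≡raised = mod-+ (- + 1) dn-class

      x+1≡lowered : x + + 1 ≡ lowered ⟨mod s ⟩
      x+1≡lowered = subst (λ c → x + + 1 ≡ c ⟨mod s ⟩) raised+1 (mod-+ (+ 1) up-class)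

    -- On the abacus χ₁(σ_i) swaps runners i - 1 and i (the first gaps x, y of λ
    -- become the gaps y - 1, x + 1 of μ).  The beads of λ on runner i - 1 from
    -- y - 1 up are pushed one step onto runner i; all other beads stay.
    Pushed : ℤ → Set
    Pushed z = z ≡ raised ⟨mod s ⟩ × y - + 1 ≤ z

    bead : ℤ → ℤ
    bead z with mod? {s} z raised ×-dec (y - + 1 ℤ.≤? z)
    ... | yes _ = z + + 1
    ... | no  _ = z

    bead-spec : ∀ z → (Pushed z × bead z ≡ z + + 1) ⊎ (¬ Pushed z × bead z ≡ z)
    bead-spec z with mod? {s} z raised ×-dec (y - + 1 ℤ.≤? z)
    ... | yes pushed = inj₁ (pushed , refl)
    ... | no  stays  = inj₂ (stays , refl)

    bead-increasing : ∀ z → z ≤ bead z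
    bead-increasing z with bead-spec z
    ... | inj₁ (_ , e) = subst (z ≤_) (sym e) (ℤP.i≤i+j z (+ 1))
    ... | inj₂ (_ , e) = ℤP.≤-reflexive (sym e)

    -- On beads of λ the map is strictly increasing: a pushed bead z cannot land
    -- on the bead z + 1, which would sit on runner i at or above y.
    bead-monotone : ∀ {z₁ z₂} → InBeta la z₁ → InBeta la z₂ → z₁ < z₂ → bead z₁ < bead z₂
    bead-monotone {z₁} {z₂} _ b₂ z₁<z₂ with bead-spec z₁
    ... | inj₂ (_ , e) = subst (_< bead z₂) (sym e) (ℤP.<-≤-trans z₁<z₂ (bead-increasing z₂))
    ... | inj₁ ((z₁≡raised , y-1≤z₁) , e) =
      subst (_< bead z₂) (sym e) (ℤP.<-≤-trans (ℤP.≤∧≢⇒< z₁+1≤z₂ z₁+1≢z₂) (bead-increasing z₂))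
      where
      z₁+1≤z₂ : z₁ + + 1 ≤ z₂
      z₁+1≤z₂ = subst (_≤ z₂) (ℤP.+-comm (+ 1) z₁) (ℤP.i<j⇒suc[i]≤j z₁<z₂)
      z₁+1≢z₂ : z₁ + + 1 ≢ z₂
      z₁+1≢z₂ refl = ℤP.<⇒≱ (λ-below dn z₂≡y b₂) y≤z₂
        where
        z₂≡y : z₁ + + 1 ≡ y ⟨mod s ⟩
        z₂≡y = mod-trans (subst (λ c → z₁ + + 1 ≡ c ⟨mod s ⟩) raised+1 (mod-+ (+ 1) z₁≡raised)) (mod-sym dn-class)
        y≤z₂ : y ≤ z₁ + + 1
        y≤z₂ = ≤-by-difference y-1≤z₁ (regroup z₁ y)
          where
          regroup : ∀ z y → (z + + 1) - y ≡ z - (y - + 1)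
          regroup = solve-∀

    bead-into-μ : ∀ {z} → InBeta la z → ¬ ¬ InBeta mu (bead z)
    bead-into-μ {z} bz with bead-spec z
    ... | inj₁ ((z≡raised , _) , e) = subst (λ w → ¬ ¬ InBeta mu w) (sym e)
      (μ-beta up (subst (λ c → z + + 1 ≡ c ⟨mod s ⟩) (sym up-moves) (mod-+ (+ 1) z≡x))
                 (subst (z + + 1 <_) (sym up-moves) (ℤP.+-monoˡ-< (+ 1) (λ-below up z≡x bz))))
      where
      z≡x : z ≡ x ⟨mod s ⟩
      z≡x = mod-trans z≡raised (mod-sym up-class)
    ... | inj₂ (¬pushed , e) = subst (λ w → ¬ ¬ InBeta mu w) (sym e)
      (let t , z≡pt = every-class-occurs p incongruent z
           m , trigger , qt = classify t
       in by-move t m z≡pt trigger qt)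
      where
      -- the coordinate p_t in the class of z decides which gap of μ lies above z
      by-move : ∀ t m → z ≡ p t ⟨mod s ⟩ → Trigger m (p t) → q t ≡ p t + shift m → ¬ ¬ InBeta mu z
      by-move t raise z≡pt pt≡raised _ =
        μ-beta dn (subst (λ c → z ≡ c ⟨mod s ⟩) (sym dn-moves) (mod-trans z≡raised (mod-sym y-1≡raised)))
                  (subst (z <_) (sym dn-moves) (ℤP.≰⇒> λ y-1≤z → ¬pushed (z≡raised , y-1≤z)))
        where
        z≡raised : z ≡ raised ⟨mod s ⟩
        z≡raised = mod-trans z≡pt pt≡raised
      by-move t lower z≡pt pt≡lowered _ =
        μ-beta up (subst (λ c → z ≡ c ⟨mod s ⟩) (sym up-moves) (mod-trans z≡lowered (mod-sym x+1≡lowered)))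
                  (subst (z <_) (sym up-moves) (ℤP.<-≤-trans (λ-below dn (mod-trans z≡lowered (mod-sym dn-class)) bz) dn≤up+1))
        where
        z≡lowered : z ≡ lowered ⟨mod s ⟩
        z≡lowered = mod-trans z≡pt pt≡lowered
      by-move t keep z≡pt _ qt =
        μ-beta t (subst (λ c → z ≡ c ⟨mod s ⟩) (sym qt′) z≡pt) (subst (z <_) (sym qt′) (λ-below t z≡pt bz))
        where
        qt′ : q t ≡ p t
        qt′ = trans qt (ℤP.+-identityʳ (p t))

    containment : la ⊆D mu
    containment = diagram-containment la mu λ n →
      ℤP.≤-trans (bead-increasing (β la n)) (dominated (β mu) (bead ∘ β la) (β-decreasing mu) bead-decreasing bead-hits n)
      where
      bead-decreasing : ∀ n → bead (β la (suc n)) < bead (β la n)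
      bead-decreasing n = bead-monotone (β⇒InBeta la (suc n)) (β⇒InBeta la n) (β-decreasing la n)
      bead-hits : ∀ n → ¬ ¬ (Σ ℕ λ m → bead (β la n) ≡ β mu m)
      bead-hits n missed = bead-into-μ (β⇒InBeta la n) (missed ∘ InBeta⇒β mu)

open import Data.Nat using (ℕ; _≤_; zero; suc)
open import Data.Integer using (ℤ)
open import Data.Fin using (Fin; _<_)
open import Data.Product using (_,_)
open Abacus using (module Action; module Containment)

lemma5p4 : (s : ℕ) → 2 ≤ s → (p : Fin s → ℤ) → IsSPoint s p → (i : Fin s)
    → (a b : Fin s) → a < b → (k : ℤ)
    → Separates s a b k p (chi1 s i p)
    → SameSide s a b k (origin s) p
    → (la mu : Partition) → CoreOf s p la → CoreOf s (chi1 s i p) mu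
    → la ⊆D mu
lemma5p4 zero () _ _ _ _ _ _ _ _ _ _ _ _ _
lemma5p4 (suc s′) _ p (_ , incongruent) i a b a<b k separated origin-side la mu λ-core μ-core =
  Containment.containment incongruent la mu λ-core μ-core
    (Action.separation⇒pair (suc s′) i p a<b k separated origin-side)
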